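{- Let $n\geq 9$ and let $\rho_0,\ldots,\rho_{n-3}\in S_n$ be involutions whose permutation representation graph is of type (B) described in the context. Then $\langle\rho_0,\ldots,\rho_{n-3}\rangle=S_n$ and $(S_n,\{\rho_0,\ldots,\rho_{n-3}\})$ is a C-group of rank $n-2$.
   Context: A C-group of rank $r$ is a pair $(G,\{\rho_0,\ldots,\rho_{r-1}\})$ with $G$ generated by the involutions $\rho_i$ such that for all $J,K\subseteq\{0,\ldots,r-1\}$, $\langle\rho_j: j\in J\rangle\cap\langle\rho_k:k\in K\rangle=\langle\rho_j : j\in J\cap K\rangle$. The permutation representation graph has vertex set $\{1,\ldots,n\}$ and an $i$-edge $\{a,b\}$ whenever $a\rho_i=b\neq a$. Type (B): there is a tree $T$ with $n-3$ vertices in $\{1,\ldots,n\}$ whose $n-4$ edges are labelled bijectively by $2,\ldots,n-3$, $\rho_k$ ($k\geq2$) being the transposition of the endpoints of the $k$-edge; $t$ is a leaf of $T$ whose incident edge has label $2$; $a_1,a_2,a_3$ are the points not in $T$; and $\rho_0=(a_2\,t)$, $\rho_1=(a_1\,a_2)(t\,a_3)$. -}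

module Defs where

open import Data.Nat using (ℕ; _≤_; _∸_)
open import Data.Fin using (Fin; toℕ)
open import Data.Fin.Permutation using (Permutation′; _⟨$⟩ʳ_; id; flip; _∘ₚ_; transpose)
open import Data.Fin.Subset using (Subset; _∈_; _∩_)
open import Data.List using (List; []; _∷_)
open import Data.List.Relation.Unary.Unique.Propositional using (Unique)
open import Data.Product using (_×_; ∃)
open import Data.Sum using (_⊎_)
open import Relation.Binary.PropositionalEquality using (_≡_; _≢_)
open import Relation.Nullary using (¬_)

_≈ₚ_ : ∀ {n} → Permutation′ n → Permutation′ n → Set
π ≈ₚ σ = ∀ x → π ⟨$⟩ʳ x ≡ σ ⟨$⟩ʳ x

data InGen {n r : ℕ} (ρ : Fin r → Permutation′ n) (J : Subset r) : Permutation′ n → Set where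
  gid  : InGen ρ J id
  ggen : ∀ {j} → j ∈ J → InGen ρ J (ρ j)
  gmul : ∀ {π σ} → InGen ρ J π → InGen ρ J σ → InGen ρ J (π ∘ₚ σ)
  ginv : ∀ {π} → InGen ρ J π → InGen ρ J (flip π)
  gext : ∀ {π σ} → π ≈ₚ σ → InGen ρ J π → InGen ρ J σ

IsInvolution : ∀ {n} → Permutation′ n → Set
IsInvolution π = ((π ∘ₚ π) ≈ₚ id) × ¬ (π ≈ₚ id)

IsCGroup : ∀ {n r} → (Fin r → Permutation′ n) → Set
IsCGroup {n} {r} ρ =
  (∀ i → IsInvolution (ρ i)) ×
  (∀ (J K : Subset r) (π : Permutation′ n) →
     ((InGen ρ J π × InGen ρ K π) → InGen ρ (J ∩ K) π) ×
     (InGen ρ (J ∩ K) π → (InGen ρ J π × InGen ρ K π)))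

-- The edge with label k of T has endpoints u k and v k (only labels k ≥ 2 are edges).
-- Walks in T: a sequence of edge labels (each ≥ 2) leading from x to y.
data Walk {n r : ℕ} (u v : Fin r → Fin n) : Fin n → Fin n → List (Fin r) → Set where
  nil  : ∀ {x} → Walk u v x x []
  step : ∀ {x y z k ks} → 2 ≤ toℕ k →
         ((x ≡ u k × y ≡ v k) ⊎ (x ≡ v k × y ≡ u k)) →
         Walk u v y z ks → Walk u v x z (k ∷ ks)

record TypeB (n : ℕ) (ρ : Fin (n ∸ 2) → Permutation′ n) : Set where
  field
    a₁ a₂ a₃ t : Fin n
    u v : Fin (n ∸ 2) → Fin n
    -- a₁, a₂, a₃ are three distinct points; T has vertex set {1..n} ∖ {a₁,a₂,a₃}
    a₁≢a₂ : a₁ ≢ a₂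
    a₁≢a₃ : a₁ ≢ a₃
    a₂≢a₃ : a₂ ≢ a₃
    u≢v : ∀ k → 2 ≤ toℕ k → u k ≢ v k
    u-inT : ∀ k → 2 ≤ toℕ k → (u k ≢ a₁) × (u k ≢ a₂) × (u k ≢ a₃)
    v-inT : ∀ k → 2 ≤ toℕ k → (v k ≢ a₁) × (v k ≢ a₂) × (v k ≢ a₃)
    connected : ∀ x y → (x ≢ a₁) × (x ≢ a₂) × (x ≢ a₃) → (y ≢ a₁) × (y ≢ a₂) × (y ≢ a₃) →
                ∃ λ ks → Walk u v x y ks
    acyclic : ∀ x ks → Walk u v x x ks → Unique ks → ks ≡ []
    t-on-2 : ∀ k → toℕ k ≡ 2 → (t ≡ u k) ⊎ (t ≡ v k)
    t-leaf : ∀ k → 2 ≤ toℕ k → (t ≡ u k) ⊎ (t ≡ v k) → toℕ k ≡ 2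
    t-inT : (t ≢ a₁) × (t ≢ a₂) × (t ≢ a₃)
    ρ₀-def : ∀ k → toℕ k ≡ 0 → ρ k ≈ₚ transpose a₂ t
    ρ₁-def : ∀ k → toℕ k ≡ 1 → ρ k ≈ₚ (transpose a₁ a₂ ∘ₚ transpose t a₃)
    ρₖ-def : ∀ k → 2 ≤ toℕ k → ρ k ≈ₚ transpose (u k) (v k)

module Submission where

-- A subgroup H of Sym(n) contains every permutation sending each point x to some y with (x y) ∈ H
-- (`from-swaps`), and (x y) ∈ ⟨ρ_S⟩ whenever x, y are joined in the graph Γ_S formed by the edges
-- of T with label in S, the edge {a₂, t} if 0 ∈ S and the edge {t, a₃} if 1, 2 ∈ S (`conn-swap`).
-- Γ_S is a forest, so two points joined in Γ_J and in Γ_K are joined in Γ_{J∩K} (`conn-∩`, from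
-- the forest lemma `walk-∩`).  Given π ∈ ⟨ρ_J⟩ ∩ ⟨ρ_K⟩, some σ ∈ ⟨ρ_{J∩K}⟩ makes π σ fix a₁
-- (`realign`); an element of ⟨ρ_S⟩ fixing a₁ moves each point within its Γ_S-component
-- (`stabiliser-conn`, using the collapse a₁ ↦ a₂, a₃ ↦ t and the centre (a₁ a₃)(a₂ t) of ⟨ρ₀, ρ₁⟩),
-- hence π σ ∈ ⟨ρ_{J∩K}⟩ and so π ∈ ⟨ρ_{J∩K}⟩.  Generation of Sym(n): Γ_⊤ joins all points but a₁,
-- and (a₁ a₃) = ρ₁ (a₂ t) ρ₁.

open import Defs
open import Data.Nat using (ℕ; zero; suc; _≤_; _<_; _+_; _∸_; z≤n; s≤s)
open import Data.Nat.Properties using (+-suc; +-identityʳ; m≤n+m; m≤n⇒m<n∨m≡n; ≤-pred; <-irrefl; ≤-trans; ∸-monoˡ-≤)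
open import Data.Fin using (Fin; toℕ; fromℕ<)
open import Data.Fin.Properties using (_≟_; toℕ-injective; toℕ-fromℕ<; toℕ<n)
open import Data.Fin.Permutation using (Permutation′; _⟨$⟩ʳ_; _⟨$⟩ˡ_; id; _∘ₚ_; transpose; inverseˡ; inverseʳ)
open import Data.Fin.Permutation.Components using () renaming (transpose to swap)
open import Data.Fin.Subset using (Subset; _∈_; _∩_; ⊤)
open import Data.Fin.Subset.Properties using (x∈p∩q⁺; ∈⊤; p∩q⊆p; p∩q⊆q) renaming (_∈?_ to _∈ˢ?_)
open import Data.Product using (_×_; _,_; proj₁; proj₂; ∃; Σ-syntax)
open import Data.Sum using (_⊎_; inj₁; inj₂)
open import Data.Empty using (⊥; ⊥-elim)
open import Relation.Nullary using (¬_; Dec; yes; no)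
open import Level using (0ℓ)
open import Relation.Binary using (Rel; IsEquivalence)
import Relation.Binary.Construct.On as On
open import Relation.Binary.PropositionalEquality
open import Function using (_∘′_; _on_)
open import Data.List using (List; []; _∷_)
open import Data.List.Membership.Propositional using () renaming (_∈_ to _∈ˡ_)
open import Data.List.Relation.Binary.Subset.Propositional using (_⊆_)
open import Data.List.Relation.Binary.Subset.Propositional.Properties using (⊆-trans; xs⊆x∷xs; ∷⁺ʳ)
open import Data.List.Relation.Unary.All as All using (All; []; _∷_)
open import Data.List.Relation.Unary.All.Properties using (¬Any⇒All¬; anti-mono)
open import Data.List.Relation.Unary.Any using (here; there)
open import Data.List.Relation.Unary.Unique.Propositional using (Unique)
open import Data.List.Relation.Unary.AllPairs using ([]; _∷_)
open import Relation.Unary using (Decidable)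
open import Relation.Binary.Construct.Closure.ReflexiveTransitive as Star using (Star; ε; _◅_; _◅◅_)

variable
  n r : ℕ

swap-matchˡ : (a b : Fin n) → swap a b a ≡ b
swap-matchˡ a b with a ≟ a
... | yes _ = refl
... | no a≢a = ⊥-elim (a≢a refl)

swap-matchʳ : (a b : Fin n) → swap a b b ≡ a
swap-matchʳ a b with b ≟ a
... | yes b≡a = b≡a
... | no _ with b ≟ b
...   | yes _ = refl
...   | no b≢b = ⊥-elim (b≢b refl)

swap-other : (a b : Fin n) {x : Fin n} → x ≢ a → x ≢ b → swap a b x ≡ x
swap-other a b {x} x≢a x≢b with x ≟ a
... | yes x≡a = ⊥-elim (x≢a x≡a)
... | no _ with x ≟ b
...   | yes x≡b = ⊥-elim (x≢b x≡b)
...   | no _ = refl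

swap-cases : (P : Fin n → Fin n → Set) {a b : Fin n} → P a b → P b a →
             (∀ x → x ≢ a → x ≢ b → P x x) → ∀ x → P x (swap a b x)
swap-cases P {a} {b} pab pba pxx x = by (x ≟ a) (x ≟ b)
  where
  by : Dec (x ≡ a) → Dec (x ≡ b) → P x (swap a b x)
  by (yes refl) _ = subst (P x) (sym (swap-matchˡ x b)) pab
  by (no _) (yes refl) = subst (P x) (sym (swap-matchʳ a x)) pba
  by (no x≢a) (no x≢b) = subst (P x) (sym (swap-other a b x≢a x≢b)) (pxx x x≢a x≢b)

swap-related : {P : Rel (Fin n) 0ℓ} → IsEquivalence P → ∀ {a b} → P a b → ∀ x → P x (swap a b x)
swap-related {P = P} eq pab = swap-cases P pab (IsEquivalence.sym eq pab) (λ x _ _ → IsEquivalence.refl eq)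

swap-sym : (a b x : Fin n) → swap a b x ≡ swap b a x
swap-sym a b = swap-cases (λ x y → y ≡ swap b a x) (sym (swap-matchʳ b a)) (sym (swap-matchˡ b a))
                 (λ x x≢a x≢b → sym (swap-other b a x≢b x≢a))

swap-involutive : (a b x : Fin n) → swap a b (swap a b x) ≡ x
swap-involutive a b = swap-cases (λ x y → swap a b y ≡ x) (swap-matchʳ a b) (swap-matchˡ a b)
                        (λ x x≢a x≢b → swap-other a b x≢a x≢b)

swap-self : (a x : Fin n) → swap a a x ≡ x
swap-self a = swap-cases (λ x y → y ≡ x) refl refl (λ _ _ _ → refl)

perm-injective : (π : Permutation′ n) {x y : Fin n} → π ⟨$⟩ʳ x ≡ π ⟨$⟩ʳ y → x ≡ y
perm-injective π {x} {y} e = trans (sym (inverseˡ π)) (trans (cong (π ⟨$⟩ˡ_) e) (inverseˡ π))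

swap-conj : (h : Permutation′ n) (a b x : Fin n) →
            h ⟨$⟩ʳ swap a b x ≡ swap (h ⟨$⟩ʳ a) (h ⟨$⟩ʳ b) (h ⟨$⟩ʳ x)
swap-conj h a b = swap-cases (λ x y → h ⟨$⟩ʳ y ≡ swap (h ⟨$⟩ʳ a) (h ⟨$⟩ʳ b) (h ⟨$⟩ʳ x))
  (sym (swap-matchˡ (h ⟨$⟩ʳ a) (h ⟨$⟩ʳ b))) (sym (swap-matchʳ (h ⟨$⟩ʳ a) (h ⟨$⟩ʳ b)))
  (λ x x≢a x≢b → sym (swap-other _ _ (x≢a ∘′ perm-injective h) (x≢b ∘′ perm-injective h)))

swap-comm : {a b c d : Fin n} → a ≢ c → a ≢ d → b ≢ c → b ≢ d →
            ∀ x → swap c d (swap a b x) ≡ swap a b (swap c d x)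
swap-comm {a = a} {b} {c} {d} a≢c a≢d b≢c b≢d x =
  trans (swap-conj (transpose c d) a b x)
        (cong₂ (λ a′ b′ → swap a′ b′ (swap c d x)) (swap-other c d a≢c a≢d) (swap-other c d b≢c b≢d))

transpose-involution : {a b : Fin n} → a ≢ b → IsInvolution (transpose a b)
transpose-involution {a = a} {b} a≢b =
  swap-involutive a b , λ ≈id → a≢b (sym (trans (sym (swap-matchˡ a b)) (≈id a)))

disjoint-pair-involution : {a b c d : Fin n} → a ≢ b → a ≢ c → a ≢ d → b ≢ c → b ≢ d →
                           IsInvolution (transpose a b ∘ₚ transpose c d)
disjoint-pair-involution {a = a} {b} {c} {d} a≢b a≢c a≢d b≢c b≢d = square , λ ≈id → a≢b (sym (moves-a ≈id))
  where
  square : ∀ x → swap c d (swap a b (swap c d (swap a b x))) ≡ x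
  square x = begin
    swap c d (swap a b (swap c d (swap a b x))) ≡⟨ cong (swap c d) (sym (swap-comm a≢c a≢d b≢c b≢d (swap a b x))) ⟩
    swap c d (swap c d (swap a b (swap a b x))) ≡⟨ swap-involutive c d _ ⟩
    swap a b (swap a b x)                       ≡⟨ swap-involutive a b x ⟩
    x                                           ∎
    where open ≡-Reasoning
  moves-a : (∀ x → swap c d (swap a b x) ≡ x) → b ≡ a
  moves-a ≈id = begin
    b                    ≡⟨ sym (swap-other c d b≢c b≢d) ⟩
    swap c d b           ≡⟨ cong (swap c d) (sym (swap-matchˡ a b)) ⟩
    swap c d (swap a b a) ≡⟨ ≈id a ⟩
    a                    ∎
    where open ≡-Reasoning

Ends : Fin n → Fin n → Fin n → Fin n → Set
Ends a b x y = (x ≡ a × y ≡ b) ⊎ (x ≡ b × y ≡ a)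

ends-sym : {a b x y : Fin n} → Ends a b x y → Ends a b y x
ends-sym (inj₁ (x≡a , y≡b)) = inj₂ (y≡b , x≡a)
ends-sym (inj₂ (x≡b , y≡a)) = inj₁ (y≡a , x≡b)

ends-start : {a b x y : Fin n} → Ends a b x y → x ≡ a ⊎ x ≡ b
ends-start (inj₁ (x≡a , _)) = inj₁ x≡a
ends-start (inj₂ (x≡b , _)) = inj₂ x≡b

ends-point : {a b x y z : Fin n} → Ends a b x y → z ≡ a ⊎ z ≡ b → z ≡ x ⊎ z ≡ y
ends-point (inj₁ (x≡a , _)) (inj₁ z≡a) = inj₁ (trans z≡a (sym x≡a))
ends-point (inj₁ (_ , y≡b)) (inj₂ z≡b) = inj₂ (trans z≡b (sym y≡b))
ends-point (inj₂ (_ , y≡a)) (inj₁ z≡a) = inj₂ (trans z≡a (sym y≡a))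
ends-point (inj₂ (x≡b , _)) (inj₂ z≡b) = inj₁ (trans z≡b (sym x≡b))

involution-resp : {π σ : Permutation′ n} → π ≈ₚ σ → IsInvolution π → IsInvolution σ
involution-resp {π = π} {σ} π≈σ (square , π≉id) =
  (λ x → trans (cong (σ ⟨$⟩ʳ_) (sym (π≈σ x))) (trans (sym (π≈σ (π ⟨$⟩ʳ x))) (square x))) ,
  (λ σ≈id → π≉id (λ x → trans (π≈σ x) (σ≈id x)))

swap-commute : (h : Permutation′ n) {a b : Fin n} → Ends a b (h ⟨$⟩ʳ a) (h ⟨$⟩ʳ b) →
               ∀ x → swap a b (h ⟨$⟩ʳ x) ≡ h ⟨$⟩ʳ swap a b x
swap-commute h {a} {b} ends x = sym (trans (swap-conj h a b x) (swap-ends ends))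
  where
  swap-ends : ∀ {a′ b′} → Ends a b a′ b′ → swap a′ b′ (h ⟨$⟩ʳ x) ≡ swap a b (h ⟨$⟩ʳ x)
  swap-ends (inj₁ (refl , refl)) = refl
  swap-ends (inj₂ (refl , refl)) = swap-sym b a (h ⟨$⟩ʳ x)

redirect : Fin n → Fin n → Fin n → Fin n → Fin n → Fin n
redirect a b c d x with x ≟ a | x ≟ c
... | yes _ | _ = b
... | no _ | yes _ = d
... | no _ | no _ = x

redirect-first : (a b c d : Fin n) → redirect a b c d a ≡ b
redirect-first a b c d with a ≟ a
... | yes _ = refl
... | no a≢a = ⊥-elim (a≢a refl)

redirect-second : {a b c d : Fin n} → c ≢ a → redirect a b c d c ≡ d
redirect-second {a = a} {c = c} c≢a with c ≟ a | c ≟ c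
... | yes c≡a | _ = ⊥-elim (c≢a c≡a)
... | no _ | yes _ = refl
... | no _ | no c≢c = ⊥-elim (c≢c refl)

redirect-other : {a b c d x : Fin n} → x ≢ a → x ≢ c → redirect a b c d x ≡ x
redirect-other {a = a} {c = c} {x = x} x≢a x≢c with x ≟ a | x ≟ c
... | yes x≡a | _ = ⊥-elim (x≢a x≡a)
... | no _ | yes x≡c = ⊥-elim (x≢c x≡c)
... | no _ | no _ = refl

module Generated (ρ : Fin r → Permutation′ n) where

  InGen-mono : {J K : Subset r} → (∀ {j} → j ∈ J → j ∈ K) → ∀ {π} → InGen ρ J π → InGen ρ K π
  InGen-mono J⊆K gid = gid
  InGen-mono J⊆K (ggen j∈J) = ggen (J⊆K j∈J)
  InGen-mono J⊆K (gmul h h′) = gmul (InGen-mono J⊆K h) (InGen-mono J⊆K h′)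
  InGen-mono J⊆K (ginv h) = ginv (InGen-mono J⊆K h)
  InGen-mono J⊆K (gext e h) = gext e (InGen-mono J⊆K h)

  invariant : {S : Subset r} {P : Rel (Fin n) 0ℓ} → IsEquivalence P →
              (∀ j → j ∈ S → ∀ x → P x (ρ j ⟨$⟩ʳ x)) → ∀ {π} → InGen ρ S π → ∀ x → P x (π ⟨$⟩ʳ x)
  invariant eq gen gid x = IsEquivalence.refl eq
  invariant eq gen (ggen j∈S) x = gen _ j∈S x
  invariant eq gen (gmul h h′) x = IsEquivalence.trans eq (invariant eq gen h x) (invariant eq gen h′ _)
  invariant {P = P} eq gen (ginv {π} h) x =
    IsEquivalence.sym eq (subst (P (π ⟨$⟩ˡ x)) (inverseʳ π) (invariant eq gen h (π ⟨$⟩ˡ x)))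
  invariant {P = P} eq gen (gext π≈σ h) x = subst (P x) (π≈σ x) (invariant eq gen h x)

  -- A map c on the points that commutes with every generator ρ_j (j ∈ S) commutes with ⟨ρ_S⟩.
  -- For constant c this says that a common fixed point of the generators is fixed by ⟨ρ_S⟩.
  commute : {S : Subset r} (c : Fin n → Fin n) → (∀ j → j ∈ S → ∀ x → ρ j ⟨$⟩ʳ c x ≡ c (ρ j ⟨$⟩ʳ x)) →
            ∀ {π} → InGen ρ S π → ∀ x → π ⟨$⟩ʳ c x ≡ c (π ⟨$⟩ʳ x)
  commute c gen gid x = refl
  commute c gen (ggen j∈S) x = gen _ j∈S x
  commute c gen (gmul {π} {σ} h h′) x = trans (cong (σ ⟨$⟩ʳ_) (commute c gen h x)) (commute c gen h′ (π ⟨$⟩ʳ x))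
  commute c gen (ginv {π} h) x = perm-injective π (begin
    π ⟨$⟩ʳ (π ⟨$⟩ˡ c x)     ≡⟨ inverseʳ π ⟩
    c x                     ≡⟨ cong c (sym (inverseʳ π)) ⟩
    c (π ⟨$⟩ʳ (π ⟨$⟩ˡ x))   ≡⟨ sym (commute c gen h (π ⟨$⟩ˡ x)) ⟩
    π ⟨$⟩ʳ c (π ⟨$⟩ˡ x)     ∎)
    where open ≡-Reasoning
  commute c gen (gext π≈σ h) x = trans (sym (π≈σ (c x))) (trans (commute c gen h x) (cong c (π≈σ x)))

  Swap : Subset r → Rel (Fin n) 0ℓ
  Swap S x y = InGen ρ S (transpose x y)

  module _ {S : Subset r} where

    swap-conjugate : ∀ {g} → InGen ρ S g → ∀ {x y} → Swap S x y → Swap S (g ⟨$⟩ʳ x) (g ⟨$⟩ʳ y)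
    swap-conjugate {g} hg {x} {y} hxy = gext conjugated (gmul (ginv hg) (gmul hxy hg))
      where
      conjugated : ∀ k → g ⟨$⟩ʳ swap x y (g ⟨$⟩ˡ k) ≡ swap (g ⟨$⟩ʳ x) (g ⟨$⟩ʳ y) k
      conjugated k = trans (swap-conj g x y (g ⟨$⟩ˡ k)) (cong (swap (g ⟨$⟩ʳ x) (g ⟨$⟩ʳ y)) (inverseʳ g))

    -- Swap S is an equivalence relation; transitivity is conjugation of (x y) by (y z).
    swap-equivalence : IsEquivalence (Swap S)
    swap-equivalence = record
      { refl = λ {x} → gext (λ k → sym (swap-self x k)) gid
      ; sym = λ {x} {y} h → gext (swap-sym x y) h
      ; trans = swap-trans
      }
      where
      swap-trans : ∀ {x y z} → Swap S x y → Swap S y z → Swap S x z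
      swap-trans {x} {y} {z} hxy hyz = by (x ≟ z) (y ≟ x) (y ≟ z)
        where
        by : Dec (x ≡ z) → Dec (y ≡ x) → Dec (y ≡ z) → Swap S x z
        by (yes refl) _ _ = gext (λ k → sym (swap-self x k)) gid
        by (no _) (yes refl) _ = hyz
        by (no _) (no _) (yes refl) = hxy
        by (no x≢z) (no y≢x) (no y≢z) =
          subst₂ (Swap S) (swap-other y z (y≢x ∘′ sym) x≢z) (swap-matchˡ y z) (swap-conjugate hyz hxy)

    open IsEquivalence swap-equivalence public
      using () renaming (refl to swap-refl; sym to swap-symm; trans to swap-trans)

    -- Induction on the number d of points not yet known to be fixed (π fixes every x < k, d + k = n):
    -- composing with (π c  c), c = k, fixes c as well.
    from-swaps : ∀ π → (∀ x → Swap S x (π ⟨$⟩ʳ x)) → InGen ρ S π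
    from-swaps π moves = fix-prefix n 0 (+-identityʳ n) π (λ _ ()) moves
      where
      fix-prefix : ∀ d k → d + k ≡ n → ∀ π → (∀ x → toℕ x < k → π ⟨$⟩ʳ x ≡ x) →
                   (∀ x → Swap S x (π ⟨$⟩ʳ x)) → InGen ρ S π
      fix-prefix zero k refl π fixes moves = gext (λ x → sym (fixes x (toℕ<n x))) gid
      fix-prefix (suc d) k d+k≡n π fixes moves =
        gext (λ x → swap-involutive y c (π ⟨$⟩ʳ x)) (gmul σ∈S (swap-symm (moves c)))
        where
        k<n : k < n
        k<n = subst (k <_) d+k≡n (s≤s (m≤n+m k d))
        c = fromℕ< k<n
        y = π ⟨$⟩ʳ c
        σ = π ∘ₚ transpose y c
        σ-fixes : ∀ x → toℕ x < suc k → σ ⟨$⟩ʳ x ≡ x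
        σ-fixes x x<1+k with m≤n⇒m<n∨m≡n (≤-pred x<1+k)
        ... | inj₂ x≡k rewrite toℕ-injective {i = x} {j = c} (trans x≡k (sym (toℕ-fromℕ< k<n))) = swap-matchˡ y c
        ... | inj₁ x<k = trans (cong (swap y c) (fixes x x<k)) (swap-other y c x≢y x≢c)
          where
          x≢c : x ≢ c
          x≢c x≡c = <-irrefl (trans (cong toℕ x≡c) (toℕ-fromℕ< k<n)) x<k
          x≢y : x ≢ y
          x≢y x≡y = x≢c (perm-injective π (trans (fixes x x<k) x≡y))
        σ∈S : InGen ρ S σ
        σ∈S = fix-prefix d (suc k) (trans (+-suc d k) d+k≡n) σ σ-fixes
                (λ x → swap-trans (moves x) (swap-related swap-equivalence (swap-symm (moves c)) (π ⟨$⟩ʳ x)))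

module Forest (u v : Fin r → Fin n) (acyclic : ∀ x ks → Walk u v x x ks → Unique ks → ks ≡ []) where

  open import Data.List.Membership.DecPropositional (_≟_ {n = r}) using () renaming (_∈?_ to _∈ˡ?_)

  PWalk : (Fin r → Set) → Rel (Fin n) 0ℓ
  PWalk P x y = ∃ λ ks → Walk u v x y ks × All P ks

  module _ {P : Fin r → Set} where

    pwalk-nil : ∀ {x} → PWalk P x x
    pwalk-nil = [] , nil , []

    pwalk-edge : ∀ {k x y} → 2 ≤ toℕ k → Ends (u k) (v k) x y → P k → PWalk P x y
    pwalk-edge 2≤k e pk = _ , step 2≤k e nil , pk ∷ []

    pwalk-++ : ∀ {x y z} → PWalk P x y → PWalk P y z → PWalk P x z
    pwalk-++ (_ , nil , []) q = q
    pwalk-++ (_ , step 2≤k e p , pk ∷ ps) q with pwalk-++ (_ , p , ps) q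
    ... | _ , w , qs = _ , step 2≤k e w , pk ∷ qs

    pwalk-reverse : ∀ {x y} → PWalk P x y → PWalk P y x
    pwalk-reverse (_ , nil , []) = pwalk-nil
    pwalk-reverse (_ , step 2≤k e p , pk ∷ ps) =
      pwalk-++ (pwalk-reverse (_ , p , ps)) (pwalk-edge 2≤k (ends-sym e) pk)

  pwalk-map : ∀ {P Q : Fin r → Set} → (∀ {m} → P m → Q m) → ∀ {x y} → PWalk P x y → PWalk Q x y
  pwalk-map P⇒Q (ks , w , ps) = ks , w , All.map P⇒Q ps

  Trail : Fin n → Fin n → List (Fin r) → Set
  Trail x y ks = ∃ λ ks′ → Walk u v x y ks′ × Unique ks′ × ks′ ⊆ ks

  restart : ∀ {x y z k ks} → Walk u v x y ks → Unique ks → k ∈ˡ ks → z ≡ u k ⊎ z ≡ v k → Trail z y ks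
  restart w@(step 2≤k e p) uq@(_ ∷ uq′) (here refl) z-end with ends-point e z-end
  ... | inj₁ refl = _ , w , uq , λ m → m
  ... | inj₂ refl = _ , p , uq′ , xs⊆x∷xs _ _
  restart (step _ _ p) (_ ∷ uq) (there k∈ks) z-end with restart p uq k∈ks z-end
  ... | ks′ , w′ , uq′ , ks′⊆ks = ks′ , w′ , uq′ , ⊆-trans ks′⊆ks (xs⊆x∷xs _ _)

  -- Every walk contains a trail with the same ends: cut out the loop at a repeated edge.
  to-trail : ∀ {x y ks} → Walk u v x y ks → Trail x y ks
  to-trail nil = [] , nil , [] , λ ()
  to-trail (step {k = k} 2≤k e p) with to-trail p
  ... | ks′ , w , uq , ks′⊆ks with k ∈ˡ? ks′
  ...   | no k∉ks′ = k ∷ ks′ , step 2≤k e w , ¬Any⇒All¬ ks′ k∉ks′ ∷ uq , ∷⁺ʳ k ks′⊆ks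
  ...   | yes k∈ks′ with restart w uq k∈ks′ (ends-start e)
  ...     | ks″ , w′ , uq′ , ks″⊆ks′ = ks″ , w′ , uq′ , ⊆-trans ks″⊆ks′ (⊆-trans ks′⊆ks (xs⊆x∷xs _ _))

  no-detour : ∀ {k x z} → 2 ≤ toℕ k → Ends (u k) (v k) x z → PWalk (k ≢_) z x → ⊥
  no-detour {k} 2≤k e (_ , w , avoids-k) with to-trail w
  ... | ks′ , w′ , uq , ks′⊆ks with acyclic _ (k ∷ ks′) (step 2≤k e w′) (anti-mono ks′⊆ks avoids-k ∷ uq)
  ... | ()

  -- Since the trail between two points is unique, a trail joining x, y along P-edges uses only
  -- Q-edges whenever x, y are also joined along Q-edges: else an edge outside Q has a detour.
  trail-∩ : ∀ {P Q : Fin r → Set} → Decidable Q → ∀ {x y ks} → Walk u v x y ks → Unique ks → All P ks →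
            PWalk Q x y → PWalk (λ m → P m × Q m) x y
  trail-∩ Q? nil _ _ _ = pwalk-nil
  trail-∩ {Q = Q} Q? (step {k = k} 2≤k e p) (k∉p ∷ uq) (pk ∷ ps) q with Q? k
  ... | yes qk = pwalk-++ (pwalk-edge 2≤k e (pk , qk))
                          (trail-∩ Q? p uq ps (pwalk-++ (pwalk-edge 2≤k (ends-sym e) qk) q))
  ... | no ¬qk = ⊥-elim (no-detour 2≤k (ends-sym e) (pwalk-++ (pwalk-map Q⇒≢k q) (pwalk-reverse (_ , p , k∉p))))
    where
    Q⇒≢k : ∀ {m} → Q m → k ≢ m
    Q⇒≢k qm k≡m = ¬qk (subst Q (sym k≡m) qm)

  walk-∩ : ∀ {P Q : Fin r → Set} → Decidable Q → ∀ {x y} → PWalk P x y → PWalk Q x y → PWalk (λ m → P m × Q m) x y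
  walk-∩ Q? (_ , w , ps) q with to-trail w
  ... | ks′ , w′ , uq , ks′⊆ks = trail-∩ Q? w′ uq (anti-mono ks′⊆ks ps) q

label-cases : ∀ m → m ≡ 0 ⊎ m ≡ 1 ⊎ 2 ≤ m
label-cases zero = inj₁ refl
label-cases (suc zero) = inj₂ (inj₁ refl)
label-cases (suc (suc m)) = inj₂ (inj₂ (s≤s (s≤s z≤n)))

-- Type (B) generators ρ_0, …, ρ_{n-3} (fields of TypeB: a₁ a₂ a₃ t u v …); the argument only needs
-- rank n - 2 ≥ 3, so that the labels 0, 1, 2 exist.
module TypeBGroup (n : ℕ) (ρ : Fin (n ∸ 2) → Permutation′ n) (B : TypeB n ρ) (3≤rank : 3 ≤ n ∸ 2) where

  open TypeB B
  open Generated ρ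
  open Forest u v acyclic

  rank : ℕ
  rank = n ∸ 2

  label : ∀ m → m < 3 → Fin rank
  label m m<3 = fromℕ< (≤-trans m<3 3≤rank)

  j₀ j₁ j₂ : Fin rank
  j₀ = label 0 (s≤s z≤n)
  j₁ = label 1 (s≤s (s≤s z≤n))
  j₂ = label 2 (s≤s (s≤s (s≤s z≤n)))

  label-unique : ∀ {j m} (m<3 : m < 3) → toℕ j ≡ m → j ≡ label m m<3
  label-unique m<3 e = toℕ-injective (trans e (sym (toℕ-fromℕ< _)))

  is-j₀ : ∀ {j} → toℕ j ≡ 0 → j ≡ j₀
  is-j₀ = label-unique (s≤s z≤n)
  is-j₁ : ∀ {j} → toℕ j ≡ 1 → j ≡ j₁
  is-j₁ = label-unique (s≤s (s≤s z≤n))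
  is-j₂ : ∀ {j} → toℕ j ≡ 2 → j ≡ j₂
  is-j₂ = label-unique (s≤s (s≤s (s≤s z≤n)))

  2≤j₂ : 2 ≤ toℕ j₂
  2≤j₂ = subst (2 ≤_) (sym (toℕ-fromℕ< _)) (s≤s (s≤s z≤n))

  InT : Fin n → Set
  InT x = (x ≢ a₁) × (x ≢ a₂) × (x ≢ a₃)

  t≢a₁ : t ≢ a₁
  t≢a₁ = proj₁ t-inT
  t≢a₂ : t ≢ a₂
  t≢a₂ = proj₁ (proj₂ t-inT)
  t≢a₃ : t ≢ a₃
  t≢a₃ = proj₂ (proj₂ t-inT)

  ends-inT : ∀ {k x y} → 2 ≤ toℕ k → Ends (u k) (v k) x y → InT x
  ends-inT {k} 2≤k (inj₁ (refl , _)) = u-inT k 2≤k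
  ends-inT {k} 2≤k (inj₂ (refl , _)) = v-inT k 2≤k

  ρ₁′ : Permutation′ n
  ρ₁′ = transpose a₁ a₂ ∘ₚ transpose t a₃

  ρ₁-a₂ : ρ₁′ ⟨$⟩ʳ a₂ ≡ a₁
  ρ₁-a₂ = trans (cong (swap t a₃) (swap-matchʳ a₁ a₂)) (swap-other t a₃ (≢-sym t≢a₁) a₁≢a₃)
  ρ₁-t : ρ₁′ ⟨$⟩ʳ t ≡ a₃
  ρ₁-t = trans (cong (swap t a₃) (swap-other a₁ a₂ t≢a₁ t≢a₂)) (swap-matchˡ t a₃)
  ρ₁-a₃ : ρ₁′ ⟨$⟩ʳ a₃ ≡ t
  ρ₁-a₃ = trans (cong (swap t a₃) (swap-other a₁ a₂ (≢-sym a₁≢a₃) (≢-sym a₂≢a₃))) (swap-matchʳ t a₃)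
  ρ₁-fixes : ∀ {x} → InT x → x ≢ t → ρ₁′ ⟨$⟩ʳ x ≡ x
  ρ₁-fixes (x≢a₁ , x≢a₂ , x≢a₃) x≢t =
    trans (cong (swap t a₃) (swap-other a₁ a₂ x≢a₁ x≢a₂)) (swap-other t a₃ x≢t x≢a₃)

  module _ {S : Subset rank} where

    ρ₀∈ : j₀ ∈ S → Swap S a₂ t
    ρ₀∈ j₀∈S = gext (ρ₀-def j₀ (toℕ-fromℕ< _)) (ggen j₀∈S)

    ρ₁∈ : j₁ ∈ S → InGen ρ S ρ₁′
    ρ₁∈ j₁∈S = gext (ρ₁-def j₁ (toℕ-fromℕ< _)) (ggen j₁∈S)

    ρₖ∈ : ∀ k → k ∈ S → 2 ≤ toℕ k → Swap S (u k) (v k)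
    ρₖ∈ k k∈S 2≤k = gext (ρₖ-def k 2≤k) (ggen k∈S)

    generator-cases : (Q : Permutation′ n → Set) → (∀ {π σ} → π ≈ₚ σ → Q π → Q σ) →
                      (j₀ ∈ S → Q (transpose a₂ t)) → (j₁ ∈ S → Q ρ₁′) →
                      (∀ k → k ∈ S → 2 ≤ toℕ k → Q (transpose (u k) (v k))) → ∀ j → j ∈ S → Q (ρ j)
    generator-cases Q resp q₀ q₁ qₖ j j∈S with label-cases (toℕ j)
    ... | inj₁ j≡0 = resp (λ x → sym (ρ₀-def j j≡0 x)) (q₀ (subst (_∈ S) (is-j₀ j≡0) j∈S))
    ... | inj₂ (inj₁ j≡1) = resp (λ x → sym (ρ₁-def j j≡1 x)) (q₁ (subst (_∈ S) (is-j₁ j≡1) j∈S))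
    ... | inj₂ (inj₂ 2≤j) = resp (λ x → sym (ρₖ-def j 2≤j x)) (qₖ j j∈S 2≤j)

    invariant-B : {P : Rel (Fin n) 0ℓ} → IsEquivalence P → (j₀ ∈ S → P a₂ t) → (j₁ ∈ S → P a₁ a₂ × P t a₃) →
                  (∀ k → k ∈ S → 2 ≤ toℕ k → P (u k) (v k)) → ∀ {π} → InGen ρ S π → ∀ x → P x (π ⟨$⟩ʳ x)
    invariant-B {P} eq p₀ p₁ pₖ = invariant eq (generator-cases (λ σ → ∀ x → P x (σ ⟨$⟩ʳ x))
      (λ π≈σ pπ x → subst (P x) (π≈σ x) (pπ x))
      (λ j₀∈S → swap-related eq (p₀ j₀∈S))
      (λ j₁∈S x → IsEquivalence.trans eq (swap-related eq (proj₁ (p₁ j₁∈S)) x)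
                                         (swap-related eq (proj₂ (p₁ j₁∈S)) _))
      (λ k k∈S 2≤k → swap-related eq (pₖ k k∈S 2≤k)))

    commute-B : (c : Fin n → Fin n) → (j₀ ∈ S → ∀ x → swap a₂ t (c x) ≡ c (swap a₂ t x)) →
                (j₁ ∈ S → ∀ x → ρ₁′ ⟨$⟩ʳ c x ≡ c (ρ₁′ ⟨$⟩ʳ x)) →
                (∀ k → k ∈ S → 2 ≤ toℕ k → ∀ x → swap (u k) (v k) (c x) ≡ c (swap (u k) (v k) x)) →
                ∀ {π} → InGen ρ S π → ∀ x → π ⟨$⟩ʳ c x ≡ c (π ⟨$⟩ʳ x)
    commute-B c c₀ c₁ cₖ = commute c (generator-cases (λ σ → ∀ x → σ ⟨$⟩ʳ c x ≡ c (σ ⟨$⟩ʳ x))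
      (λ π≈σ cπ x → trans (sym (π≈σ (c x))) (trans (cπ x) (cong c (π≈σ x)))) c₀ c₁ cₖ)

  data Link (S : Subset rank) (x y : Fin n) : Set where
    tree-link : ∀ k → k ∈ S → 2 ≤ toℕ k → Ends (u k) (v k) x y → Link S x y
    link₀ : j₀ ∈ S → Ends a₂ t x y → Link S x y
    link₁₂ : j₁ ∈ S → j₂ ∈ S → Ends t a₃ x y → Link S x y

  Conn : Subset rank → Rel (Fin n) 0ℓ
  Conn S = Star (Link S)

  link-sym : ∀ {S x y} → Link S x y → Link S y x
  link-sym (tree-link k k∈S 2≤k e) = tree-link k k∈S 2≤k (ends-sym e)
  link-sym (link₀ j₀∈S e) = link₀ j₀∈S (ends-sym e)
  link-sym (link₁₂ j₁∈S j₂∈S e) = link₁₂ j₁∈S j₂∈S (ends-sym e)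

  conn-reverse : ∀ {S x y} → Conn S x y → Conn S y x
  conn-reverse = Star.reverse link-sym

  conn-equivalence : ∀ {S} → IsEquivalence (Conn S)
  conn-equivalence = record { refl = ε ; sym = conn-reverse ; trans = _◅◅_ }

  neighbour : Σ[ w ∈ Fin n ] InT w × w ≢ t × Ends (u j₂) (v j₂) t w
  neighbour with t-on-2 j₂ (toℕ-fromℕ< _)
  ... | inj₁ t≡u = v j₂ , v-inT j₂ 2≤j₂ , (λ v≡t → u≢v j₂ 2≤j₂ (trans (sym t≡u) (sym v≡t))) , inj₁ (t≡u , refl)
  ... | inj₂ t≡v = u j₂ , u-inT j₂ 2≤j₂ , (λ u≡t → u≢v j₂ 2≤j₂ (trans u≡t t≡v)) , inj₂ (t≡v , refl)

  module _ {S : Subset rank} where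

    ends-swap : ∀ {a b x y} → Swap S a b → Ends a b x y → Swap S x y
    ends-swap s (inj₁ (refl , refl)) = s
    ends-swap s (inj₂ (refl , refl)) = swap-symm s

    -- For the neighbour w of t, (a₃ w) = ρ₁ (t w) ρ₁; so (t a₃) ∈ ⟨ρ_S⟩ by transitivity.
    t-a₃-swap : j₁ ∈ S → j₂ ∈ S → Swap S t a₃
    t-a₃-swap j₁∈S j₂∈S with neighbour
    ... | w , w∈T , w≢t , e = swap-trans t-w (swap-symm a₃-w)
      where
      t-w : Swap S t w
      t-w = ends-swap (ρₖ∈ j₂ j₂∈S 2≤j₂) e
      a₃-w : Swap S a₃ w
      a₃-w = subst₂ (Swap S) ρ₁-t (ρ₁-fixes w∈T w≢t) (swap-conjugate (ρ₁∈ j₁∈S) t-w)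

    link-swap : ∀ {x y} → Link S x y → Swap S x y
    link-swap (tree-link k k∈S 2≤k e) = ends-swap (ρₖ∈ k k∈S 2≤k) e
    link-swap (link₀ j₀∈S e) = ends-swap (ρ₀∈ j₀∈S) e
    link-swap (link₁₂ j₁∈S j₂∈S e) = ends-swap (t-a₃-swap j₁∈S j₂∈S) e

    conn-swap : ∀ {x y} → Conn S x y → Swap S x y
    conn-swap = Star.fold (Swap S) (λ l s → swap-trans (link-swap l) s) swap-refl

    walk-conn : ∀ {x y} → PWalk (_∈ S) x y → Conn S x y
    walk-conn (_ , nil , []) = ε
    walk-conn (_ , step 2≤k e w , k∈S ∷ ks∈S) = tree-link _ k∈S 2≤k e ◅ walk-conn (_ , w , ks∈S)

  -- hub sends the pendant points a₂ and a₃ of Γ to t; links of Γ_S become T-walks on labels in S.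
  hub : Fin n → Fin n
  hub = redirect a₂ t a₃ t

  hub-T : ∀ {x} → InT x → hub x ≡ x
  hub-T (_ , x≢a₂ , x≢a₃) = redirect-other x≢a₂ x≢a₃

  hub-a₂ : hub a₂ ≡ t
  hub-a₂ = redirect-first a₂ t a₃ t

  hub-a₃ : hub a₃ ≡ t
  hub-a₃ = redirect-second (≢-sym a₂≢a₃)

  hub-t : hub t ≡ t
  hub-t = hub-T t-inT

  module _ {S : Subset rank} where

    link-walk : ∀ {x y} → Link S x y → PWalk (_∈ S) (hub x) (hub y)
    link-walk (tree-link k k∈S 2≤k e) =
      subst₂ (PWalk (_∈ S)) (sym (hub-T (ends-inT 2≤k e))) (sym (hub-T (ends-inT 2≤k (ends-sym e))))
             (pwalk-edge 2≤k e k∈S)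
    link-walk (link₀ _ (inj₁ (refl , refl))) = subst₂ (PWalk (_∈ S)) (sym hub-a₂) (sym hub-t) pwalk-nil
    link-walk (link₀ _ (inj₂ (refl , refl))) = subst₂ (PWalk (_∈ S)) (sym hub-t) (sym hub-a₂) pwalk-nil
    link-walk (link₁₂ _ _ (inj₁ (refl , refl))) = subst₂ (PWalk (_∈ S)) (sym hub-t) (sym hub-a₃) pwalk-nil
    link-walk (link₁₂ _ _ (inj₂ (refl , refl))) = subst₂ (PWalk (_∈ S)) (sym hub-a₃) (sym hub-t) pwalk-nil

    conn-walk : ∀ {x y} → Conn S x y → PWalk (_∈ S) (hub x) (hub y)
    conn-walk ε = pwalk-nil
    conn-walk (l ◅ c) = pwalk-++ (link-walk l) (conn-walk c)

  -- What Γ_S must contain for a link to leave x: the edge {a₂, t} at a₂, the edge {t, a₃} at a₃.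
  Exit : Subset rank → Fin n → Set
  Exit S x = (x ≡ a₂ → j₀ ∈ S) × (x ≡ a₃ → j₁ ∈ S × j₂ ∈ S)

  exit-∩ : ∀ {J K x} → Exit J x → Exit K x → Exit (J ∩ K) x
  exit-∩ (J₀ , J₁₂) (K₀ , K₁₂) =
    (λ x≡a₂ → x∈p∩q⁺ (J₀ x≡a₂ , K₀ x≡a₂)) ,
    (λ x≡a₃ → x∈p∩q⁺ (proj₁ (J₁₂ x≡a₃) , proj₁ (K₁₂ x≡a₃)) , x∈p∩q⁺ (proj₂ (J₁₂ x≡a₃) , proj₂ (K₁₂ x≡a₃)))

  module _ {S : Subset rank} where

    exit-T : ∀ {x} → InT x → Exit S x
    exit-T (_ , x≢a₂ , x≢a₃) = (λ x≡a₂ → ⊥-elim (x≢a₂ x≡a₂)) , (λ x≡a₃ → ⊥-elim (x≢a₃ x≡a₃))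

    link-exit : ∀ {x y} → Link S x y → Exit S x
    link-exit (tree-link k _ 2≤k e) = exit-T (ends-inT 2≤k e)
    link-exit (link₀ j₀∈S (inj₁ (refl , _))) = (λ _ → j₀∈S) , (λ a₂≡a₃ → ⊥-elim (a₂≢a₃ a₂≡a₃))
    link-exit (link₀ _ (inj₂ (refl , _))) = exit-T t-inT
    link-exit (link₁₂ _ _ (inj₁ (refl , _))) = exit-T t-inT
    link-exit (link₁₂ j₁∈S j₂∈S (inj₂ (refl , _))) = (λ a₃≡a₂ → ⊥-elim (a₂≢a₃ (sym a₃≡a₂))) , (λ _ → j₁∈S , j₂∈S)

    exit-start : ∀ {x y} → Conn S x y → x ≢ y → Exit S x
    exit-start ε x≢x = ⊥-elim (x≢x refl)
    exit-start (l ◅ _) _ = link-exit l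

    exit-hub : ∀ {x} → Exit S x → Conn S x (hub x)
    exit-hub {x} (x₀ , x₁₂) = by (x ≟ a₂) (x ≟ a₃)
      where
      by : Dec (x ≡ a₂) → Dec (x ≡ a₃) → Conn S x (hub x)
      by (yes refl) _ = subst (Conn S a₂) (sym hub-a₂) (link₀ (x₀ refl) (inj₁ (refl , refl)) ◅ ε)
      by (no _) (yes refl) =
        subst (Conn S a₃) (sym hub-a₃) (link₁₂ (proj₁ (x₁₂ refl)) (proj₂ (x₁₂ refl)) (inj₂ (refl , refl)) ◅ ε)
      by (no x≢a₂) (no x≢a₃) = subst (Conn S x) (sym (redirect-other x≢a₂ x≢a₃)) ε

  -- Points joined in Γ_J and in Γ_K are joined in Γ_{J∩K}: both ends reach their hubs in Γ_{J∩K},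
  -- and the hubs are joined in T along labels of J ∩ K by the forest lemma `walk-∩`.
  conn-∩ : ∀ J K {x y} → Conn J x y → Conn K x y → Conn (J ∩ K) x y
  conn-∩ J K {x} {y} p q with x ≟ y
  ... | yes refl = ε
  ... | no x≢y = to-hub p q x≢y
              ◅◅ walk-conn (pwalk-map x∈p∩q⁺ (walk-∩ (_∈ˢ? K) (conn-walk p) (conn-walk q)))
              ◅◅ conn-reverse (to-hub (conn-reverse p) (conn-reverse q) (≢-sym x≢y))
    where
    to-hub : ∀ {x y} → Conn J x y → Conn K x y → x ≢ y → Conn (J ∩ K) x (hub x)
    to-hub p q x≢y = exit-hub (exit-∩ (exit-start p x≢y) (exit-start q x≢y))

  -- collapse identifies a₁ with a₂ and a₃ with t.  Every element of ⟨ρ_S⟩ moves points only within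
  -- the Γ_S-components of the collapsed points: ρ₁ swaps a₁ ↔ a₂ and t ↔ a₃, both collapsed away.
  collapse : Fin n → Fin n
  collapse = redirect a₁ a₂ a₃ t

  collapse-a₁ : collapse a₁ ≡ a₂
  collapse-a₁ = redirect-first a₁ a₂ a₃ t

  collapse-a₃ : collapse a₃ ≡ t
  collapse-a₃ = redirect-second (≢-sym a₁≢a₃)

  collapse-T : ∀ {x} → InT x → collapse x ≡ x
  collapse-T (x≢a₁ , _ , x≢a₃) = redirect-other x≢a₁ x≢a₃

  collapse-a₂ : collapse a₂ ≡ a₂
  collapse-a₂ = redirect-other (≢-sym a₁≢a₂) a₂≢a₃

  collapse-invariant : ∀ {S π} → InGen ρ S π → ∀ x → Conn S (collapse x) (collapse (π ⟨$⟩ʳ x))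
  collapse-invariant {S} = invariant-B {P = Conn S on collapse} (On.isEquivalence collapse conn-equivalence)
    (λ j₀∈S → at a₂ t collapse-a₂ (collapse-T t-inT) (link₀ j₀∈S (inj₁ (refl , refl)) ◅ ε))
    (λ _ → at a₁ a₂ collapse-a₁ collapse-a₂ ε , at t a₃ (collapse-T t-inT) collapse-a₃ ε)
    (λ k k∈S 2≤k → at (u k) (v k) (collapse-T (u-inT k 2≤k)) (collapse-T (v-inT k 2≤k))
                      (tree-link k k∈S 2≤k (inj₁ (refl , refl)) ◅ ε))
    where
    at : ∀ x′ y′ {x y} → collapse x′ ≡ x → collapse y′ ≡ y → Conn S x y → Conn S (collapse x′) (collapse y′)
    at _ _ p q = subst₂ (Conn S) (sym p) (sym q)

  -- Without ρ₁ nothing moves a point c ∉ T ∪ {a₂}: the other generators live on T ∪ {a₂}.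
  fixed-without-ρ₁ : ∀ {S π c} → ¬ (j₁ ∈ S) → c ≢ a₂ → (∀ {y} → InT y → y ≢ c) → InGen ρ S π → π ⟨$⟩ʳ c ≡ c
  fixed-without-ρ₁ {c = c} j₁∉S c≢a₂ off-T h = commute-B (λ _ → c)
    (λ _ _ → swap-other a₂ t c≢a₂ (≢-sym (off-T t-inT)))
    (λ j₁∈S → ⊥-elim (j₁∉S j₁∈S))
    (λ k _ 2≤k _ → swap-other (u k) (v k) (≢-sym (off-T (u-inT k 2≤k))) (≢-sym (off-T (v-inT k 2≤k))))
    h c

  -- (a₁ a₃)(a₂ t) is central in the dihedral group ⟨ρ₀, ρ₁⟩ on the square a₁ a₂ a₃ t, and it fixes
  -- T ∖ {t}; so without ρ₂ it commutes with all of ⟨ρ_S⟩.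
  centre : Permutation′ n
  centre = transpose a₁ a₃ ∘ₚ transpose a₂ t

  centre-a₁ : centre ⟨$⟩ʳ a₁ ≡ a₃
  centre-a₁ = trans (cong (swap a₂ t) (swap-matchˡ a₁ a₃)) (swap-other a₂ t (≢-sym a₂≢a₃) (≢-sym t≢a₃))
  centre-a₂ : centre ⟨$⟩ʳ a₂ ≡ t
  centre-a₂ = trans (cong (swap a₂ t) (swap-other a₁ a₃ (≢-sym a₁≢a₂) a₂≢a₃)) (swap-matchˡ a₂ t)
  centre-t : centre ⟨$⟩ʳ t ≡ a₂
  centre-t = trans (cong (swap a₂ t) (swap-other a₁ a₃ t≢a₁ t≢a₃)) (swap-matchʳ a₂ t)
  centre-a₃ : centre ⟨$⟩ʳ a₃ ≡ a₁
  centre-a₃ = trans (cong (swap a₂ t) (swap-matchʳ a₁ a₃)) (swap-other a₂ t a₁≢a₂ (≢-sym t≢a₁))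
  centre-fixes : ∀ {x} → InT x → x ≢ t → centre ⟨$⟩ʳ x ≡ x
  centre-fixes (x≢a₁ , x≢a₂ , x≢a₃) x≢t =
    trans (cong (swap a₂ t) (swap-other a₁ a₃ x≢a₁ x≢a₃)) (swap-other a₂ t x≢a₂ x≢t)

  ρ₁-centre : ∀ x → ρ₁′ ⟨$⟩ʳ (centre ⟨$⟩ʳ x) ≡ centre ⟨$⟩ʳ (ρ₁′ ⟨$⟩ʳ x)
  ρ₁-centre x = begin
    swap t a₃ (swap a₁ a₂ (c x))              ≡⟨ swap-comm (≢-sym t≢a₁) a₁≢a₃ (≢-sym t≢a₂) a₂≢a₃ (c x) ⟩
    swap a₁ a₂ (swap t a₃ (c x))              ≡⟨ swap-sym a₁ a₂ (swap t a₃ (c x)) ⟩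
    swap a₂ a₁ (swap t a₃ (c x))              ≡⟨ cong (swap a₂ a₁) (swap-sym t a₃ (c x)) ⟩
    swap a₂ a₁ (swap a₃ t (c x))
      ≡⟨ cong₂ (λ a b → swap a₂ a₁ (swap a b (c x))) (sym centre-a₁) (sym centre-a₂) ⟩
    swap a₂ a₁ (swap (c a₁) (c a₂) (c x))     ≡⟨ cong (swap a₂ a₁) (sym (swap-conj centre a₁ a₂ x)) ⟩
    swap a₂ a₁ (c (swap a₁ a₂ x))
      ≡⟨ cong₂ (λ a b → swap a b (c (swap a₁ a₂ x))) (sym centre-t) (sym centre-a₃) ⟩
    swap (c t) (c a₃) (c (swap a₁ a₂ x))      ≡⟨ sym (swap-conj centre t a₃ (swap a₁ a₂ x)) ⟩
    c (swap t a₃ (swap a₁ a₂ x))              ∎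
    where
    open ≡-Reasoning
    c : Fin n → Fin n
    c = centre ⟨$⟩ʳ_

  commutes-with-centre : ∀ {S π} → ¬ (j₂ ∈ S) → InGen ρ S π → ∀ x → π ⟨$⟩ʳ (centre ⟨$⟩ʳ x) ≡ centre ⟨$⟩ʳ (π ⟨$⟩ʳ x)
  commutes-with-centre {S} j₂∉S = commute-B (centre ⟨$⟩ʳ_)
    (λ _ → swap-commute centre (inj₂ (centre-a₂ , centre-t)))
    (λ _ → ρ₁-centre)
    (λ k k∈S 2≤k → swap-commute centre
      (inj₁ (centre-fixes (u-inT k 2≤k) (off-t k∈S 2≤k ∘′ inj₁ ∘′ sym) ,
             centre-fixes (v-inT k 2≤k) (off-t k∈S 2≤k ∘′ inj₂ ∘′ sym))))
    where
    off-t : ∀ {k} → k ∈ S → 2 ≤ toℕ k → ¬ (t ≡ u k ⊎ t ≡ v k)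
    off-t {k} k∈S 2≤k t-on-k = j₂∉S (subst (_∈ S) (is-j₂ (t-leaf k 2≤k t-on-k)) k∈S)

  stays-off : (π : Permutation′ n) {c x : Fin n} → π ⟨$⟩ʳ c ≡ c → x ≢ c → π ⟨$⟩ʳ x ≢ c
  stays-off π π-fixes x≢c πx≡c = x≢c (perm-injective π (trans πx≡c (sym π-fixes)))

  module _ {S : Subset rank} {π : Permutation′ n} (π∈S : InGen ρ S π) (π-fixes-a₁ : π ⟨$⟩ʳ a₁ ≡ a₁) where

    -- An element of ⟨ρ_S⟩ fixing a₁ fixes a₃ too, unless Γ_S contains the edge {t, a₃}:
    -- without ρ₁ both points are fixed, without ρ₂ the permutation commutes with the centre.
    a₃-fixed-or-linked : π ⟨$⟩ʳ a₃ ≡ a₃ ⊎ (j₁ ∈ S × j₂ ∈ S)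
    a₃-fixed-or-linked with j₁ ∈ˢ? S | j₂ ∈ˢ? S
    ... | no j₁∉S | _ = inj₁ (fixed-without-ρ₁ j₁∉S (≢-sym a₂≢a₃) (proj₂ ∘′ proj₂) π∈S)
    ... | yes j₁∈S | yes j₂∈S = inj₂ (j₁∈S , j₂∈S)
    ... | yes _ | no j₂∉S = inj₁ (begin
      π ⟨$⟩ʳ a₃                  ≡⟨ cong (π ⟨$⟩ʳ_) (sym centre-a₁) ⟩
      π ⟨$⟩ʳ (centre ⟨$⟩ʳ a₁)    ≡⟨ commutes-with-centre j₂∉S π∈S a₁ ⟩
      centre ⟨$⟩ʳ (π ⟨$⟩ʳ a₁)    ≡⟨ cong (centre ⟨$⟩ʳ_) π-fixes-a₁ ⟩
      centre ⟨$⟩ʳ a₁             ≡⟨ centre-a₁ ⟩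
      a₃                         ∎)
      where open ≡-Reasoning

    fixed : ∀ {x} → π ⟨$⟩ʳ x ≡ x → Conn S x (π ⟨$⟩ʳ x)
    fixed {x} πx≡x = subst (Conn S x) (sym πx≡x) ε

    stabiliser-conn : ∀ x → Conn S x (π ⟨$⟩ʳ x)
    stabiliser-conn x with a₃-fixed-or-linked | x ≟ a₁ | x ≟ a₃
    ... | _ | yes refl | _ = fixed π-fixes-a₁
    ... | inj₁ π-fixes-a₃ | no _ | yes refl = fixed π-fixes-a₃
    ... | inj₁ π-fixes-a₃ | no x≢a₁ | no x≢a₃ =
      subst₂ (Conn S) (redirect-other x≢a₁ x≢a₃)
             (redirect-other (stays-off π π-fixes-a₁ x≢a₁) (stays-off π π-fixes-a₃ x≢a₃))
             (collapse-invariant π∈S x)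
    ... | inj₂ (j₁∈S , j₂∈S) | no x≢a₁ | _ =
      to-collapse x≢a₁ ◅◅ collapse-invariant π∈S x ◅◅ conn-reverse (to-collapse (stays-off π π-fixes-a₁ x≢a₁))
      where
      to-collapse : ∀ {y} → y ≢ a₁ → Conn S y (collapse y)
      to-collapse {y} y≢a₁ = by (y ≟ a₃)
        where
        by : Dec (y ≡ a₃) → Conn S y (collapse y)
        by (yes refl) = subst (Conn S a₃) (sym collapse-a₃) (link₁₂ j₁∈S j₂∈S (inj₂ (refl , refl)) ◅ ε)
        by (no y≢a₃) = subst (Conn S y) (sym (redirect-other y≢a₁ y≢a₃)) ε

  return-to-a₁ : ∀ {S} → j₁ ∈ S → ∀ y → Swap S a₂ (collapse y) →
                 Σ[ σ ∈ Permutation′ n ] InGen ρ S σ × σ ⟨$⟩ʳ y ≡ a₁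
  return-to-a₁ {S} j₁∈S y s = by (y ≟ a₁) (y ≟ a₃)
    where
    by : Dec (y ≡ a₁) → Dec (y ≡ a₃) → Σ[ σ ∈ Permutation′ n ] InGen ρ S σ × σ ⟨$⟩ʳ y ≡ a₁
    by (yes y≡a₁) _ = id , gid , y≡a₁
    by (no _) (yes refl) =
      ρ₁′ ∘ₚ transpose a₂ t ∘ₚ ρ₁′ ,
      gmul (ρ₁∈ j₁∈S) (gmul (subst (Swap S a₂) collapse-a₃ s) (ρ₁∈ j₁∈S)) ,
      trans (cong (λ z → ρ₁′ ⟨$⟩ʳ swap a₂ t z) ρ₁-a₃) (trans (cong (ρ₁′ ⟨$⟩ʳ_) (swap-matchʳ a₂ t)) ρ₁-a₂)
    by (no y≢a₁) (no y≢a₃) =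
      transpose a₂ y ∘ₚ ρ₁′ ,
      gmul (subst (Swap S a₂) (redirect-other y≢a₁ y≢a₃) s) (ρ₁∈ j₁∈S) ,
      trans (cong (ρ₁′ ⟨$⟩ʳ_) (swap-matchʳ a₂ y)) ρ₁-a₂

  -- A common element π of ⟨ρ_J⟩ and ⟨ρ_K⟩ is moved back onto a₁ by some σ ∈ ⟨ρ_{J∩K}⟩:
  -- collapse(π a₁) is joined to a₂ in Γ_J and in Γ_K, hence in Γ_{J∩K}.
  realign : ∀ J K {π} → InGen ρ J π → InGen ρ K π →
            Σ[ σ ∈ Permutation′ n ] InGen ρ (J ∩ K) σ × σ ⟨$⟩ʳ (π ⟨$⟩ʳ a₁) ≡ a₁
  realign J K {π} π∈J π∈K with j₁ ∈ˢ? J | j₁ ∈ˢ? K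
  ... | no j₁∉J | _ = id , gid , fixed-without-ρ₁ j₁∉J a₁≢a₂ proj₁ π∈J
  ... | yes _ | no j₁∉K = id , gid , fixed-without-ρ₁ j₁∉K a₁≢a₂ proj₁ π∈K
  ... | yes j₁∈J | yes j₁∈K =
    return-to-a₁ (x∈p∩q⁺ (j₁∈J , j₁∈K)) (π ⟨$⟩ʳ a₁) (conn-swap (conn-∩ J K (from-a₂ π∈J) (from-a₂ π∈K)))
    where
    from-a₂ : ∀ {S} → InGen ρ S π → Conn S a₂ (collapse (π ⟨$⟩ʳ a₁))
    from-a₂ {S} π∈S = subst (λ z → Conn S z (collapse (π ⟨$⟩ʳ a₁))) collapse-a₁ (collapse-invariant π∈S a₁)

  -- The intersection property: π σ fixes a₁, so it moves points within Γ_J- and Γ_K-components,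
  -- hence within Γ_{J∩K}-components, and is thus a product of transpositions in ⟨ρ_{J∩K}⟩.
  intersection : ∀ J K {π} → InGen ρ J π → InGen ρ K π → InGen ρ (J ∩ K) π
  intersection J K {π} π∈J π∈K with realign J K π∈J π∈K
  ... | σ , σ∈J∩K , σ-returns = gext (λ x → inverseˡ σ) (gmul πσ∈J∩K (ginv σ∈J∩K))
    where
    πσ∈J : InGen ρ J (π ∘ₚ σ)
    πσ∈J = gmul π∈J (InGen-mono (p∩q⊆p J K) σ∈J∩K)
    πσ∈K : InGen ρ K (π ∘ₚ σ)
    πσ∈K = gmul π∈K (InGen-mono (p∩q⊆q J K) σ∈J∩K)
    πσ∈J∩K : InGen ρ (J ∩ K) (π ∘ₚ σ)
    πσ∈J∩K = from-swaps (π ∘ₚ σ) (λ x →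
      conn-swap (conn-∩ J K (stabiliser-conn πσ∈J σ-returns x) (stabiliser-conn πσ∈K σ-returns x)))

  -- Every point is swapped with t in ⟨ρ_0, …, ρ_{n-3}⟩: T is connected, a₂ and a₃ hang at t,
  -- and (a₁ a₃) = ρ₁ (a₂ t) ρ₁.
  swap-with-t : ∀ x → Swap ⊤ x t
  swap-with-t x with x ≟ a₁ | x ≟ a₂ | x ≟ a₃
  ... | yes refl | _ | _ = swap-trans (subst₂ (Swap ⊤) ρ₁-a₂ ρ₁-t (swap-conjugate (ρ₁∈ ∈⊤) (ρ₀∈ ∈⊤)))
                                      (swap-symm (t-a₃-swap ∈⊤ ∈⊤))
  ... | no _ | yes refl | _ = ρ₀∈ ∈⊤
  ... | no _ | no _ | yes refl = swap-symm (t-a₃-swap ∈⊤ ∈⊤)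
  ... | no x≢a₁ | no x≢a₂ | no x≢a₃ with connected x t (x≢a₁ , x≢a₂ , x≢a₃) t-inT
  ...   | ks , w = conn-swap (walk-conn (ks , w , All.tabulate (λ _ → ∈⊤)))

  symmetric-group : ∀ π → InGen ρ ⊤ π
  symmetric-group π = from-swaps π (λ x → swap-trans (swap-with-t x) (swap-symm (swap-with-t (π ⟨$⟩ʳ x))))

  involutions : ∀ j → IsInvolution (ρ j)
  involutions j = generator-cases {S = ⊤} IsInvolution (λ {π} {σ} → involution-resp {π = π} {σ})
    (λ _ → transpose-involution (≢-sym t≢a₂))
    (λ _ → disjoint-pair-involution a₁≢a₂ (≢-sym t≢a₁) a₁≢a₃ (≢-sym t≢a₂) a₂≢a₃)
    (λ k _ 2≤k → transpose-involution (u≢v k 2≤k))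
    j ∈⊤

  c-group : IsCGroup ρ
  c-group = involutions , λ J K π →
    (λ (π∈J , π∈K) → intersection J K π∈J π∈K) ,
    (λ π∈J∩K → InGen-mono (p∩q⊆p J K) π∈J∩K , InGen-mono (p∩q⊆q J K) π∈J∩K)

lemma6p3 : (n : ℕ) → 9 ≤ n → (ρ : Fin (n ∸ 2) → Permutation′ n) → TypeB n ρ →
           (∀ (π : Permutation′ n) → InGen ρ ⊤ π) × IsCGroup ρ
lemma6p3 n 9≤n ρ B = symmetric-group , c-group
  where
  3≤rank : 3 ≤ n ∸ 2
  3≤rank = ≤-trans (s≤s (s≤s (s≤s z≤n))) (∸-monoˡ-≤ 2 9≤n)
  open TypeBGroup n ρ B 3≤rank
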